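{- Every extensional $\mathbf{BC^\pm I}$-algebra, with $a^\bullet:=\mathbf{C}^+\,\mathbf{I}\,a$, is an extensional $\mathbf{BI}(\_)^\bullet$-algebra.
   Context: Applicative structure: a set with binary application written by juxtaposition, left associative; $a\circ b:=\mathbf{B}\,a\,b$. An extensional $\mathbf{BC^\pm I}$-algebra is an applicative structure with elements $\mathbf{B},\mathbf{C}^+,\mathbf{C}^-,\mathbf{I}$ such that for all $a,b,c$, all $\star\in\{+,-\}$ and all $\varepsilon\in\{+,-\}$ (with $-\varepsilon$ the opposite sign): $\mathbf{B}\,a\,b\,c=a\,(b\,c)$; $\mathbf{C}^\star\,a\,b\,c=a\,c\,b$; $\mathbf{I}\,a=a$; $\mathbf{C}^+\,a\,b=\mathbf{C}^-\,a\,b$; $\mathbf{B}\,\mathbf{I}=\mathbf{I}$; $\mathbf{C}^\star\,\mathbf{B}\,\mathbf{I}=\mathbf{I}$; $(\mathbf{B}\,\mathbf{B})\circ\mathbf{B}=(\mathbf{C}^\star\,\mathbf{B}\,\mathbf{B})\circ(\mathbf{B}\circ\mathbf{B})$; $\mathbf{C}^\varepsilon\circ\mathbf{C}^{ -\varepsilon}=\mathbf{I}$; $(\mathbf{B}\,\mathbf{C}^\varepsilon)\circ(\mathbf{B}\circ\mathbf{B})=(\mathbf{C}^\star\,\mathbf{B}\,\mathbf{C}^\varepsilon)\circ(\mathbf{B}\circ\mathbf{B})$; $(\mathbf{B}\,\mathbf{C}^\varepsilon)\circ(\mathbf{C}^\varepsilon\circ(\mathbf{B}\,\mathbf{C}^\varepsilon))=\mathbf{C}^\varepsilon\circ((\mathbf{B}\,\mathbf{C}^\varepsilon)\circ\mathbf{C}^\varepsilon)$;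 $(\mathbf{B}\,\mathbf{B})\circ\mathbf{C}^\varepsilon=\mathbf{C}^\varepsilon\circ((\mathbf{B}\,\mathbf{C}^\varepsilon)\circ\mathbf{B})$. An extensional $\mathbf{BI}(\_)^\bullet$-algebra is an applicative structure with elements $\mathbf{B},\mathbf{I}$ and a function $a\mapsto a^\bullet$ such that for all $a,b,c$: $\mathbf{I}\,a=a$; $\mathbf{B}\,a\,b\,c=a\,(b\,c)$; $a^\bullet\,b=b\,a$; $\mathbf{B}\,\mathbf{I}=\mathbf{I}$; $(a\,b)^\bullet=\mathbf{B}\,b^\bullet\,(\mathbf{B}\,a^\bullet\,\mathbf{B})$; $\mathbf{B}\,\mathbf{B}^\bullet\,(\mathbf{B}\,\mathbf{B}\,(\mathbf{B}\,\mathbf{B}\,\mathbf{B}))=\mathbf{B}\,(\mathbf{B}\,\mathbf{B})\,\mathbf{B}$; $\mathbf{B}\,\mathbf{I}^\bullet\,\mathbf{B}=\mathbf{I}$; $\mathbf{B}\,a^{\bullet\bullet}\,\mathbf{B}=\mathbf{B}\,(\mathbf{B}\,a^\bullet)\,\mathbf{B}$. -}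

module Defs where

open import Level using (Level; suc)
open import Relation.Binary.PropositionalEquality using (_≡_)

record Applicative (ℓ : Level) : Set (suc ℓ) where
  infixl 9 _·_
  field
    Carrier : Set ℓ
    _·_     : Carrier → Carrier → Carrier

data Sign : Set where
  plus minus : Sign

neg : Sign → Sign
neg plus  = minus
neg minus = plus

selC : {ℓ : Level} {X : Set ℓ} → X → X → Sign → X
selC c⁺ c⁻ plus  = c⁺
selC c⁺ c⁻ minus = c⁻

comp : {ℓ : Level} (A : Applicative ℓ) (B : Applicative.Carrier A)
  → Applicative.Carrier A → Applicative.Carrier A → Applicative.Carrier A
comp A B a b = Applicative._·_ A (Applicative._·_ A B a) b

record IsBC±IAlgebra {ℓ : Level} (A : Applicative ℓ)
  (B C⁺ C⁻ I : Applicative.Carrier A) : Set ℓ where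
  open Applicative A
  private
    C : Sign → Carrier
    C = selC C⁺ C⁻
    _∘_ : Carrier → Carrier → Carrier
    _∘_ = comp A B
    infixr 8 _∘_
  field
    B-ax   : ∀ a b c → B · a · b · c ≡ a · (b · c)
    C-ax   : ∀ s a b c → C s · a · b · c ≡ a · c · b
    I-ax   : ∀ a → I · a ≡ a
    C±     : ∀ a b → C⁺ · a · b ≡ C⁻ · a · b
    BI     : B · I ≡ I
    CBI    : ∀ s → C s · B · I ≡ I
    BBB    : ∀ s → (B · B) ∘ B ≡ (C s · B · B) ∘ (B ∘ B)
    CC     : ∀ e → C e ∘ C (neg e) ≡ I
    BCBB   : ∀ s e → (B · C e) ∘ (B ∘ B) ≡ (C s · B · C e) ∘ (B ∘ B)
    BCCBC  : ∀ e → (B · C e) ∘ (C e ∘ (B · C e)) ≡ C e ∘ ((B · C e) ∘ C e)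
    BBC    : ∀ e → (B · B) ∘ C e ≡ C e ∘ ((B · C e) ∘ B)

record IsBI•Algebra {ℓ : Level} (A : Applicative ℓ)
  (B I : Applicative.Carrier A) (_• : Applicative.Carrier A → Applicative.Carrier A) : Set ℓ where
  open Applicative A
  field
    I-ax    : ∀ a → I · a ≡ a
    B-ax    : ∀ a b c → B · a · b · c ≡ a · (b · c)
    •-ax    : ∀ a b → (a •) · b ≡ b · a
    BI      : B · I ≡ I
    •-app   : ∀ a b → ((a · b) •) ≡ B · (b •) · (B · (a •) · B)
    B•      : B · (B •) · (B · B · (B · B · B)) ≡ B · (B · B) · B
    BI•B    : B · (I •) · B ≡ I
    B••B    : ∀ a → B · ((a •) •) · B ≡ B · (B · (a •)) · B

{-# OPTIONS --safe #-}
-- Applied to enough arguments, the closed axioms yield the familiar combinator laws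
-- B x I = x, B I x = x, B (B x y) z = B x (B y z), B (C x y) z = C (B x z) y and
-- B x (C y z) = C (B (B x) y) z. The one non-obvious ingredient is the splitting law
-- C x (u w) = C (C (B B x) u) w, obtained by writing C x (u w) = B (C⁻ x) u w and using
-- C⁺ ∘ C⁻ = I = C⁻ ∘ C⁺ to push the flips outward. It turns (u w)• and B (a••) B into terms of
-- the shape C t v, which the swap law identifies with the required right-hand sides.
module Submission where

open import Defs
open import Level using (Level)
open import Relation.Binary.PropositionalEquality
  using (_≡_; sym; trans; cong; module ≡-Reasoning)

module BC±IAlgebraProperties {ℓ : Level} (A : Applicative ℓ) {B C⁺ C⁻ I : Applicative.Carrier A}
  (isBC±I : IsBC±IAlgebra A B C⁺ C⁻ I) where

  open Applicative A
  open IsBC±IAlgebra isBC±I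
  open ≡-Reasoning

  B-identityˡ : ∀ x → B · I · x ≡ x
  B-identityˡ x = trans (cong (_· x) BI) (I-ax x)

  B-identityʳ : ∀ x → B · x · I ≡ x
  B-identityʳ x = begin
    B · x · I      ≡˘⟨ C-ax plus B I x ⟩
    C⁺ · B · I · x ≡⟨ cong (_· x) (CBI plus) ⟩
    I · x          ≡⟨ I-ax x ⟩
    x              ∎

  C⁺-C⁻-inverse : ∀ x → C⁺ · (C⁻ · x) ≡ x
  C⁺-C⁻-inverse x = trans (sym (B-ax C⁺ C⁻ x)) (trans (cong (_· x) (CC plus)) (I-ax x))

  C⁺-C⁺-applied : ∀ f u → C⁺ · (C⁺ · f) · u ≡ f · u
  C⁺-C⁺-applied f u = begin
    C⁺ · (C⁺ · f) · u    ≡⟨ C± (C⁺ · f) u ⟩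
    C⁻ · (C⁺ · f) · u    ≡˘⟨ cong (_· u) (B-ax C⁻ C⁺ f) ⟩
    B · C⁻ · C⁺ · f · u  ≡⟨ cong (λ t → t · f · u) (CC minus) ⟩
    I · f · u            ≡⟨ cong (_· u) (I-ax f) ⟩
    f · u                ∎

  B-B-C⁺ : ∀ x → B · B · (C⁺ · x) ≡ C⁺ · (B · C⁺ · (B · x))
  B-B-C⁺ x = begin
    B · B · (C⁺ · x)                  ≡˘⟨ B-ax (B · B) C⁺ x ⟩
    B · (B · B) · C⁺ · x              ≡⟨ cong (_· x) (BBC plus) ⟩
    B · C⁺ · (B · (B · C⁺) · B) · x   ≡⟨ B-ax C⁺ (B · (B · C⁺) · B) x ⟩
    C⁺ · (B · (B · C⁺) · B · x)       ≡⟨ cong (C⁺ ·_) (B-ax (B · C⁺) B x) ⟩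
    C⁺ · (B · C⁺ · (B · x))           ∎

  B-C⁺-partial : ∀ x y → B · (C⁺ · x · y) ≡ C⁺ · (B · C⁺ · (B · x)) · y
  B-C⁺-partial x y = trans (sym (B-ax B (C⁺ · x) y)) (cong (_· y) (B-B-C⁺ x))

  B-C⁺-swap : ∀ x y z → B · (C⁺ · x · y) · z ≡ C⁺ · (B · x · z) · y
  B-C⁺-swap x y z = begin
    B · (C⁺ · x · y) · z             ≡⟨ cong (_· z) (B-C⁺-partial x y) ⟩
    C⁺ · (B · C⁺ · (B · x)) · y · z  ≡⟨ C-ax plus (B · C⁺ · (B · x)) y z ⟩
    B · C⁺ · (B · x) · z · y         ≡⟨ cong (_· y) (B-ax C⁺ (B · x) z) ⟩
    C⁺ · (B · x · z) · y             ∎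

  B-B-B : ∀ x → B · B · (B · x) ≡ B · (B · (B · x)) · B
  B-B-B x = begin
    B · B · (B · x)                     ≡˘⟨ B-ax (B · B) B x ⟩
    B · (B · B) · B · x                 ≡⟨ cong (_· x) (BBB plus) ⟩
    B · (C⁺ · B · B) · (B · B · B) · x  ≡⟨ B-ax (C⁺ · B · B) (B · B · B) x ⟩
    C⁺ · B · B · (B · B · B · x)        ≡⟨ C-ax plus B B (B · B · B · x) ⟩
    B · (B · B · B · x) · B             ≡⟨ cong (λ t → B · t · B) (B-ax B B x) ⟩
    B · (B · (B · x)) · B               ∎

  B-assoc : ∀ x y z → B · (B · x · y) · z ≡ B · x · (B · y · z)
  B-assoc x y z = begin
    B · (B · x · y) · z            ≡˘⟨ cong (_· z) (B-ax B (B · x) y) ⟩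
    B · B · (B · x) · y · z        ≡⟨ cong (λ t → t · y · z) (B-B-B x) ⟩
    B · (B · (B · x)) · B · y · z  ≡⟨ cong (_· z) (B-ax (B · (B · x)) B y) ⟩
    B · (B · x) · (B · y) · z      ≡⟨ B-ax (B · x) (B · y) z ⟩
    B · x · (B · y · z)            ∎

  B-C⁺-B-B : ∀ x → B · C⁺ · (B · (B · x)) ≡ B · (B · (B · x)) · C⁺
  B-C⁺-B-B x = begin
    B · C⁺ · (B · (B · x))                ≡˘⟨ cong (B · C⁺ ·_) (B-ax B B x) ⟩
    B · C⁺ · (B · B · B · x)              ≡˘⟨ B-ax (B · C⁺) (B · B · B) x ⟩
    B · (B · C⁺) · (B · B · B) · x        ≡⟨ cong (_· x) (BCBB plus plus) ⟩
    B · (C⁺ · B · C⁺) · (B · B · B) · x   ≡⟨ B-ax (C⁺ · B · C⁺) (B · B · B) x ⟩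
    C⁺ · B · C⁺ · (B · B · B · x)         ≡⟨ C-ax plus B C⁺ (B · B · B · x) ⟩
    B · (B · B · B · x) · C⁺              ≡⟨ cong (λ t → B · t · C⁺) (B-ax B B x) ⟩
    B · (B · (B · x)) · C⁺                ∎

  C⁺-B-B : ∀ x y z → C⁺ · (B · (B · x) · y) · z ≡ B · x · (C⁺ · y · z)
  C⁺-B-B x y z = begin
    C⁺ · (B · (B · x) · y) · z      ≡˘⟨ cong (_· z) (B-ax C⁺ (B · (B · x)) y) ⟩
    B · C⁺ · (B · (B · x)) · y · z  ≡⟨ cong (λ t → t · y · z) (B-C⁺-B-B x) ⟩
    B · (B · (B · x)) · C⁺ · y · z  ≡⟨ cong (_· z) (B-ax (B · (B · x)) C⁺ y) ⟩
    B · (B · x) · (C⁺ · y) · z      ≡⟨ B-ax (B · x) (C⁺ · y) z ⟩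
    B · x · (C⁺ · y · z)            ∎

  C⁺-B-C⁻ : ∀ x u → C⁺ · (B · (C⁻ · x) · u) ≡ C⁺ · (B · B · x) · u
  C⁺-B-C⁻ x u = begin
    C⁺ · (B · (C⁻ · x) · u)                      ≡˘⟨ B-ax C⁺ (B · (C⁻ · x)) u ⟩
    B · C⁺ · (B · (C⁻ · x)) · u                  ≡˘⟨ C⁺-C⁺-applied (B · C⁺ · (B · (C⁻ · x))) u ⟩
    C⁺ · (C⁺ · (B · C⁺ · (B · (C⁻ · x)))) · u    ≡˘⟨ cong (λ t → C⁺ · t · u) (B-B-C⁺ (C⁻ · x)) ⟩
    C⁺ · (B · B · (C⁺ · (C⁻ · x))) · u           ≡⟨ cong (λ t → C⁺ · (B · B · t) · u) (C⁺-C⁻-inverse x) ⟩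
    C⁺ · (B · B · x) · u                         ∎

  C⁺-expand-· : ∀ x u w → C⁺ · x · (u · w) ≡ C⁺ · (C⁺ · (B · B · x) · u) · w
  C⁺-expand-· x u w = begin
    C⁺ · x · (u · w)                     ≡⟨ C± x (u · w) ⟩
    C⁻ · x · (u · w)                     ≡˘⟨ B-ax (C⁻ · x) u w ⟩
    B · (C⁻ · x) · u · w                 ≡˘⟨ C⁺-C⁺-applied (B · (C⁻ · x) · u) w ⟩
    C⁺ · (C⁺ · (B · (C⁻ · x) · u)) · w   ≡⟨ cong (λ t → C⁺ · t · w) (C⁺-B-C⁻ x u) ⟩
    C⁺ · (C⁺ · (B · B · x) · u) · w      ∎

  C⁺-BBB-C⁺I : C⁺ · (B · B · B) · (C⁺ · I) ≡ B · C⁺ · B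
  C⁺-BBB-C⁺I = begin
    C⁺ · (B · B · B) · (C⁺ · I)                  ≡˘⟨ B-C⁺-swap B (C⁺ · I) B ⟩
    B · (C⁺ · B · (C⁺ · I)) · B                  ≡⟨ cong (λ t → B · t · B) (C⁺-expand-· B C⁺ I) ⟩
    B · (C⁺ · (C⁺ · (B · B · B) · C⁺) · I) · B   ≡˘⟨ cong (λ t → B · (C⁺ · t · I) · B) (B-C⁺-swap B C⁺ B) ⟩
    B · (C⁺ · (B · (C⁺ · B · C⁺) · B) · I) · B   ≡˘⟨ cong (λ t → B · t · B) (B-C⁺-swap (C⁺ · B · C⁺) I B) ⟩
    B · (B · (C⁺ · (C⁺ · B · C⁺) · I) · B) · B   ≡⟨ B-assoc (C⁺ · (C⁺ · B · C⁺) · I) B B ⟩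
    B · (C⁺ · (C⁺ · B · C⁺) · I) · (B · B · B)   ≡⟨ B-C⁺-swap (C⁺ · B · C⁺) I (B · B · B) ⟩
    C⁺ · (B · (C⁺ · B · C⁺) · (B · B · B)) · I   ≡˘⟨ cong (λ t → C⁺ · t · I) (BCBB plus plus) ⟩
    C⁺ · (B · (B · C⁺) · (B · B · B)) · I        ≡⟨ C⁺-B-B C⁺ (B · B · B) I ⟩
    B · C⁺ · (C⁺ · (B · B · B) · I)              ≡˘⟨ cong (B · C⁺ ·_) (B-C⁺-swap B I B) ⟩
    B · C⁺ · (B · (C⁺ · B · I) · B)              ≡⟨ cong (λ t → B · C⁺ · (B · t · B)) (CBI plus) ⟩
    B · C⁺ · (B · I · B)                         ≡⟨ cong (B · C⁺ ·_) (B-identityˡ B) ⟩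
    B · C⁺ · B                                   ∎

  _• : Carrier → Carrier
  a • = C⁺ · I · a

  •-applied : ∀ a b → (a •) · b ≡ b · a
  •-applied a b = trans (C-ax plus I a b) (cong (_· a) (I-ax b))

  •-of-· : ∀ u w → ((u · w) •) ≡ B · (w •) · (B · (u •) · B)
  •-of-· u w = begin
    C⁺ · I · (u · w)                             ≡⟨ C⁺-expand-· I u w ⟩
    C⁺ · (C⁺ · (B · B · I) · u) · w              ≡⟨ cong (λ t → C⁺ · (C⁺ · t · u) · w) (B-identityʳ B) ⟩
    C⁺ · (C⁺ · B · u) · w                        ≡˘⟨ cong (λ t → C⁺ · (C⁺ · t · u) · w) (B-identityˡ B) ⟩
    C⁺ · (C⁺ · (B · I · B) · u) · w              ≡˘⟨ cong (λ t → C⁺ · t · w) (B-C⁺-swap I u B) ⟩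
    C⁺ · (B · (u •) · B) · w                     ≡˘⟨ cong (λ t → C⁺ · t · w) (B-identityˡ (B · (u •) · B)) ⟩
    C⁺ · (B · I · (B · (u •) · B)) · w           ≡˘⟨ B-C⁺-swap I w (B · (u •) · B) ⟩
    B · (w •) · (B · (u •) · B)                  ∎

  B-B•-BBB : B · (B •) · (B · B · (B · B · B)) ≡ B · (B · B) · B
  B-B•-BBB = begin
    B · (B •) · (B · B · (B · B · B))         ≡˘⟨ B-assoc (B •) B (B · B · B) ⟩
    B · (B · (B •) · B) · (B · B · B)         ≡⟨ cong (λ t → B · t · (B · B · B)) (B-C⁺-swap I B B) ⟩
    B · (C⁺ · (B · I · B) · B) · (B · B · B)  ≡⟨ cong (λ t → B · (C⁺ · t · B) · (B · B · B)) (B-identityˡ B) ⟩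
    B · (C⁺ · B · B) · (B · B · B)            ≡˘⟨ BBB plus ⟩
    B · (B · B) · B                           ∎

  B-I•-B : B · (I •) · B ≡ I
  B-I•-B = begin
    B · (I •) · B          ≡⟨ B-C⁺-swap I I B ⟩
    C⁺ · (B · I · B) · I   ≡⟨ cong (λ t → C⁺ · t · I) (B-identityˡ B) ⟩
    C⁺ · B · I             ≡⟨ CBI plus ⟩
    I                      ∎

  B-• : ∀ a → B · (a •) ≡ C⁺ · C⁺ · a
  B-• a = begin
    B · (a •)                      ≡⟨ B-C⁺-partial I a ⟩
    C⁺ · (B · C⁺ · (B · I)) · a    ≡⟨ cong (λ t → C⁺ · (B · C⁺ · t) · a) BI ⟩
    C⁺ · (B · C⁺ · I) · a          ≡⟨ cong (λ t → C⁺ · t · a) (B-identityʳ C⁺) ⟩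
    C⁺ · C⁺ · a                    ∎

  B-••-B : ∀ a → B · ((a •) •) · B ≡ B · (B · (a •)) · B
  B-••-B a = begin
    B · ((a •) •) · B                      ≡⟨ B-C⁺-swap I (a •) B ⟩
    C⁺ · (B · I · B) · (a •)               ≡⟨ cong (λ t → C⁺ · t · (a •)) (B-identityˡ B) ⟩
    C⁺ · B · (C⁺ · I · a)                  ≡⟨ C⁺-expand-· B (C⁺ · I) a ⟩
    C⁺ · (C⁺ · (B · B · B) · (C⁺ · I)) · a ≡⟨ cong (λ t → C⁺ · t · a) C⁺-BBB-C⁺I ⟩
    C⁺ · (B · C⁺ · B) · a                  ≡˘⟨ B-C⁺-swap C⁺ a B ⟩
    B · (C⁺ · C⁺ · a) · B                  ≡˘⟨ cong (λ t → B · t · B) (B-• a) ⟩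
    B · (B · (a •)) · B                    ∎

  isBI•Algebra : IsBI•Algebra A B I _•
  isBI•Algebra = record
    { I-ax  = I-ax
    ; B-ax  = B-ax
    ; •-ax  = •-applied
    ; BI    = BI
    ; •-app = •-of-·
    ; B•    = B-B•-BBB
    ; BI•B  = B-I•-B
    ; B••B  = B-••-B
    }

lemma5p5 : {ℓ : Level} (A : Applicative ℓ) (B C⁺ C⁻ I : Applicative.Carrier A)
    → IsBC±IAlgebra A B C⁺ C⁻ I
    → IsBI•Algebra A B I (λ a → Applicative._·_ A (Applicative._·_ A C⁺ I) a)
lemma5p5 A B C⁺ C⁻ I isBC±I = BC±IAlgebraProperties.isBI•Algebra A isBC±I
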